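{- Every proof $\delta$ of PCMLL has a normal form, i.e. can be transformed into a proof of the same sequent containing no $k$-extended-redex for any $k\ge 0$.
   Context: PCMLL (de Groote's partially commutative intuitionistic multiplicative linear logic) in natural deduction, sequent style. Formulas are built from propositional variables with the commutative product $\otimes$, the non-commutative product $\odot$, the commutative implication $\multimap$ and the non-commutative implications $\backslash$ and $/$. A context is a finite multiset of formula occurrences with a series–parallel partial order, written by terms $(\Gamma,\Delta)$ (disjoint union, no order between the two parts) and $\langle\Gamma;\Delta\rangle$ (every element of $\Gamma$ precedes every element of $\Delta$); contexts equal as partially ordered multisets are identified. $\Gamma[\;]$ is a context with a hole and $\Gamma[\Delta]$ the result of filling it with $\Delta$. Rules: axiom $A\vdash A$; $\backslash_e$: from $\Gamma\vdash A$ and $\Delta\vdash A\backslash C$ infer $\langle\Gamma;\Delta\rangle\vdash C$; $/_e$: from $\Delta\vdash C/A$ and $\Gamma\vdash A$ infer $\langle\Delta;\Gamma\rangle\vdash C$; $\multimap_e$: from $\Gamma\vdash A$ and $\Delta\vdash A\multimap C$ infer $(\Gamma,\Delta)\vdash C$; $\backslash_i$: from $\langle A;\Gamma\rangle\vdash C$ infer $\Gamma\vdash A\backslash C$; $/_i$: from $\langle\Gamma;A\rangle\vdash C$ infer $\Gamma\vdash C/A$; $\multimap_i$: from $(A,\Gamma)\vdash C$ infer $\Gamma\vdash A\multimap C$; $\odot_i$: from $\Delta\vdash A$, $\Gamma\vdash B$ infer $\langle\Delta;\Gamma\rangle\vdash A\odot B$; $\otimes_i$: from $\Delta\vdash A$,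 $\Gamma\vdash B$ infer $(\Delta,\Gamma)\vdash A\otimes B$; $\odot_e$: from $\Delta\vdash A\odot B$ and $\Gamma[\langle A;B\rangle]\vdash C$ infer $\Gamma[\Delta]\vdash C$; $\otimes_e$: from $\Delta\vdash A\otimes B$ and $\Gamma[(A,B)]\vdash C$ infer $\Gamma[\Delta]\vdash C$ (in both product eliminations the occurrences $A,B$ are equivalent: any other element is below $A$ iff below $B$ and above $A$ iff above $B$; $A<B$ for $\odot_e$, incomparable for $\otimes_e$; they are replaced by $\Delta$); entropy: from $\Gamma\vdash C$ infer $\Gamma'\vdash C$ whenever $\Gamma'$ has the same underlying multiset as $\Gamma$ and every order relation of $\Gamma'$ holds in $\Gamma$. Principal branch $B(S_0)$ of a sequent occurrence $S_0$: the smallest set containing $S_0$ such that for $S\in B(S_0)$: if $S$ is concluded by a unary rule (including entropy) its premise is in it; if by a product elimination, the premise $\Gamma[\langle A;B\rangle]\vdash C$ (resp. $\Gamma[(A,B)]\vdash C$) is in it; if by an implication elimination, the premise carrying the implication is in it. Redexes (0-extended-redexes): an introduction of $\backslash,/,\multimap,\odot,\otimes$ whose conclusion is the premise carrying the main connective of an immediately following elimination of the same connective; and a product elimination whose premise $\langle A;B\rangle\vdash A\odot B$ (resp. $(A,B)\vdash A\otimes B$) is concluded by the introduction from axioms $A\vdash A$, $B\vdash B$. A $k$-extended-redex: for an elimination rule with major premise $S_0$ (premise whose right-hand formula has the eliminated connective as main connective), a path $S_0,\dots,S_k$ in $B(S_0)$ (each $S_{i+1}$ the premise in $B(S_0)$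 of the rule concluding $S_i$) with $S_k$ the conclusion of an introduction rule and $S_0,S_k$ having the same right-hand formula. A proof is in normal form if it contains no $k$-extended-redex for any $k\ge0$. -}

module Defs where

open import Data.Nat using (ℕ; zero; suc)
open import Data.Product using (Σ; _×_; _,_; proj₁; proj₂)
open import Data.Sum using (_⊎_)
open import Data.List using (List; []; _∷_)
open import Data.List.Membership.Propositional using (_∈_)
open import Function.Bundles using (_↔_; Inverse)
open import Relation.Binary.PropositionalEquality using (_≡_)
open import Relation.Nullary using (¬_)

infixr 6 _⊗_ _⊙_
infixr 5 _⊸_ _＼_
infixl 5 _／_

data Formula : Set where
  var : ℕ → Formula
  _⊗_ : Formula → Formula → Formula   -- commutative product
  _⊙_ : Formula → Formula → Formula   -- non-commutative product
  _⊸_ : Formula → Formula → Formula   -- commutative implication  A ⊸ C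
  _＼_ : Formula → Formula → Formula
  _／_ : Formula → Formula → Formula

-- Contexts: series-parallel terms denoting partially ordered multisets.
-- ε is the empty context.

data Ctx : Set where
  ε     : Ctx
  [_]   : Formula → Ctx
  _,,_  : Ctx → Ctx → Ctx     -- (Γ , Δ) : no order between the parts
  ⟨_⨾_⟩ : Ctx → Ctx → Ctx     -- ⟨Γ ; Δ⟩ : every element of Γ precedes every element of Δ

data Pos : Ctx → Set where
  here : ∀ {A} → Pos [ A ]
  pl   : ∀ {Γ Δ} → Pos Γ → Pos (Γ ,, Δ)
  pr   : ∀ {Γ Δ} → Pos Δ → Pos (Γ ,, Δ)
  sl   : ∀ {Γ Δ} → Pos Γ → Pos ⟨ Γ ⨾ Δ ⟩
  sr   : ∀ {Γ Δ} → Pos Δ → Pos ⟨ Γ ⨾ Δ ⟩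

label : ∀ {Γ} → Pos Γ → Formula
label (here {A}) = A
label (pl p) = label p
label (pr p) = label p
label (sl p) = label p
label (sr p) = label p

data Prec : ∀ {Γ} → Pos Γ → Pos Γ → Set where
  pl-pl : ∀ {Γ Δ} {p q : Pos Γ} → Prec p q → Prec (pl {Γ} {Δ} p) (pl q)
  pr-pr : ∀ {Γ Δ} {p q : Pos Δ} → Prec p q → Prec (pr {Γ} {Δ} p) (pr q)
  sl-sl : ∀ {Γ Δ} {p q : Pos Γ} → Prec p q → Prec (sl {Γ} {Δ} p) (sl q)
  sr-sr : ∀ {Γ Δ} {p q : Pos Δ} → Prec p q → Prec (sr {Γ} {Δ} p) (sr q)
  sl-sr : ∀ {Γ Δ} {p : Pos Γ} {q : Pos Δ} → Prec (sl p) (sr q)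

record _≅_ (Θ Γ : Ctx) : Set where
  field
    bij  : Pos Θ ↔ Pos Γ
    lab  : ∀ p → label (Inverse.to bij p) ≡ label p
    ord  : ∀ p q → Prec p q → Prec (Inverse.to bij p) (Inverse.to bij q)
    ord⁻ : ∀ p q → Prec (Inverse.to bij p) (Inverse.to bij q) → Prec p q

-- Θ ≼ Γ : same underlying multiset, and every order relation of Θ holds in Γ
-- (side condition of the entropy rule, from Γ ⊢ C infer Θ ⊢ C)
record _≼_ (Θ Γ : Ctx) : Set where
  field
    bij  : Pos Θ ↔ Pos Γ
    lab  : ∀ p → label (Inverse.to bij p) ≡ label p
    ord  : ∀ p q → Prec p q → Prec (Inverse.to bij p) (Inverse.to bij q)

data HCtx : Set where
  hole : HCtx
  parL : HCtx → Ctx → HCtx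
  parR : Ctx → HCtx → HCtx
  serL : HCtx → Ctx → HCtx
  serR : Ctx → HCtx → HCtx

fill : HCtx → Ctx → Ctx
fill hole       Δ = Δ
fill (parL H Γ) Δ = fill H Δ ,, Γ
fill (parR Γ H) Δ = Γ ,, fill H Δ
fill (serL H Γ) Δ = ⟨ fill H Δ ⨾ Γ ⟩
fill (serR Γ H) Δ = ⟨ Γ ⨾ fill H Δ ⟩

-- Natural deduction proofs.  Contexts are identified up to ≅: every rule
-- may present its conclusion by any context equal (as a poset) to the
-- displayed one.

infix 2 _⊢_

data _⊢_ : Ctx → Formula → Set where
  ax  : ∀ {Θ A} → Θ ≅ [ A ] → Θ ⊢ A
  ＼e : ∀ {Θ Γ Δ A C} → Γ ⊢ A → Δ ⊢ A ＼ C → Θ ≅ ⟨ Γ ⨾ Δ ⟩ → Θ ⊢ C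
  ／e : ∀ {Θ Γ Δ A C} → Δ ⊢ C ／ A → Γ ⊢ A → Θ ≅ ⟨ Δ ⨾ Γ ⟩ → Θ ⊢ C
  ⊸e  : ∀ {Θ Γ Δ A C} → Γ ⊢ A → Δ ⊢ A ⊸ C → Θ ≅ (Γ ,, Δ) → Θ ⊢ C
  ＼i : ∀ {Θ Γ A C} → ⟨ [ A ] ⨾ Γ ⟩ ⊢ C → Θ ≅ Γ → Θ ⊢ A ＼ C
  ／i : ∀ {Θ Γ A C} → ⟨ Γ ⨾ [ A ] ⟩ ⊢ C → Θ ≅ Γ → Θ ⊢ C ／ A
  ⊸i  : ∀ {Θ Γ A C} → ([ A ] ,, Γ) ⊢ C → Θ ≅ Γ → Θ ⊢ A ⊸ C
  ⊙i  : ∀ {Θ Γ Δ A B} → Δ ⊢ A → Γ ⊢ B → Θ ≅ ⟨ Δ ⨾ Γ ⟩ → Θ ⊢ A ⊙ B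
  ⊗i  : ∀ {Θ Γ Δ A B} → Δ ⊢ A → Γ ⊢ B → Θ ≅ (Δ ,, Γ) → Θ ⊢ A ⊗ B
  ⊙e  : ∀ {Θ Δ A B C} → Δ ⊢ A ⊙ B → (H : HCtx) → fill H ⟨ [ A ] ⨾ [ B ] ⟩ ⊢ C →
        Θ ≅ fill H Δ → Θ ⊢ C
  ⊗e  : ∀ {Θ Δ A B C} → Δ ⊢ A ⊗ B → (H : HCtx) → fill H ([ A ] ,, [ B ]) ⊢ C →
        Θ ≅ fill H Δ → Θ ⊢ C
  ent : ∀ {Θ Γ C} → Γ ⊢ C → Θ ≼ Γ → Θ ⊢ C

AnyProof : Set
AnyProof = Σ Ctx λ Γ → Σ Formula λ C → Γ ⊢ C

pk : ∀ {Γ C} → Γ ⊢ C → AnyProof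
pk {Γ} {C} d = Γ , C , d

premises : ∀ {Θ C} → Θ ⊢ C → List AnyProof
premises (ax _)         = []
premises (＼e d₁ d₂ _)  = pk d₁ ∷ pk d₂ ∷ []
premises (／e d₁ d₂ _)  = pk d₁ ∷ pk d₂ ∷ []
premises (⊸e d₁ d₂ _)   = pk d₁ ∷ pk d₂ ∷ []
premises (＼i d _)      = pk d ∷ []
premises (／i d _)      = pk d ∷ []
premises (⊸i d _)       = pk d ∷ []
premises (⊙i d₁ d₂ _)   = pk d₁ ∷ pk d₂ ∷ []
premises (⊗i d₁ d₂ _)   = pk d₁ ∷ pk d₂ ∷ []
premises (⊙e d₁ _ d₂ _) = pk d₁ ∷ pk d₂ ∷ []
premises (⊗e d₁ _ d₂ _) = pk d₁ ∷ pk d₂ ∷ []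
premises (ent d _)      = pk d ∷ []

data IsIntro : ∀ {Θ C} → Θ ⊢ C → Set where
  i＼ : ∀ {Θ Γ A C} {d : ⟨ [ A ] ⨾ Γ ⟩ ⊢ C} {e : Θ ≅ Γ} → IsIntro (＼i d e)
  i／ : ∀ {Θ Γ A C} {d : ⟨ Γ ⨾ [ A ] ⟩ ⊢ C} {e : Θ ≅ Γ} → IsIntro (／i d e)
  i⊸  : ∀ {Θ Γ A C} {d : ([ A ] ,, Γ) ⊢ C} {e : Θ ≅ Γ} → IsIntro (⊸i d e)
  i⊙  : ∀ {Θ Γ Δ A B} {d₁ : Δ ⊢ A} {d₂ : Γ ⊢ B} {e : Θ ≅ ⟨ Δ ⨾ Γ ⟩} → IsIntro (⊙i d₁ d₂ e)
  i⊗  : ∀ {Θ Γ Δ A B} {d₁ : Δ ⊢ A} {d₂ : Γ ⊢ B} {e : Θ ≅ (Δ ,, Γ)} → IsIntro (⊗i d₁ d₂ e)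

-- ReachIntro F k d : starting from the sequent concluded by d, there is a path
-- S₀ = (conclusion of d), S₁, …, S_k in the principal branch B(S₀) (each S_{i+1}
-- the premise in B(S₀) of the rule concluding S_i) such that S_k is the
-- conclusion of an introduction rule and has right-hand formula F.
data ReachIntro (F : Formula) : ℕ → ∀ {Θ C} → Θ ⊢ C → Set where
  stop : ∀ {Θ} {d : Θ ⊢ F} → IsIntro d → ReachIntro F zero d
  via-ent : ∀ {k Θ Γ C} {d : Γ ⊢ C} {e : Θ ≼ Γ} →
            ReachIntro F k d → ReachIntro F (suc k) (ent d e)
  via-＼i : ∀ {k Θ Γ A C} {d : ⟨ [ A ] ⨾ Γ ⟩ ⊢ C} {e : Θ ≅ Γ} →
            ReachIntro F k d → ReachIntro F (suc k) (＼i d e)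
  via-／i : ∀ {k Θ Γ A C} {d : ⟨ Γ ⨾ [ A ] ⟩ ⊢ C} {e : Θ ≅ Γ} →
            ReachIntro F k d → ReachIntro F (suc k) (／i d e)
  via-⊸i  : ∀ {k Θ Γ A C} {d : ([ A ] ,, Γ) ⊢ C} {e : Θ ≅ Γ} →
            ReachIntro F k d → ReachIntro F (suc k) (⊸i d e)
  via-＼e : ∀ {k Θ Γ Δ A C} {d₁ : Γ ⊢ A} {d₂ : Δ ⊢ A ＼ C} {e : Θ ≅ ⟨ Γ ⨾ Δ ⟩} →
            ReachIntro F k d₂ → ReachIntro F (suc k) (＼e d₁ d₂ e)
  via-／e : ∀ {k Θ Γ Δ A C} {d₁ : Δ ⊢ C ／ A} {d₂ : Γ ⊢ A} {e : Θ ≅ ⟨ Δ ⨾ Γ ⟩} →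
            ReachIntro F k d₁ → ReachIntro F (suc k) (／e d₁ d₂ e)
  via-⊸e  : ∀ {k Θ Γ Δ A C} {d₁ : Γ ⊢ A} {d₂ : Δ ⊢ A ⊸ C} {e : Θ ≅ (Γ ,, Δ)} →
            ReachIntro F k d₂ → ReachIntro F (suc k) (⊸e d₁ d₂ e)
  via-⊙e  : ∀ {k Θ Δ A B C H} {d₁ : Δ ⊢ A ⊙ B} {d₂ : fill H ⟨ [ A ] ⨾ [ B ] ⟩ ⊢ C}
              {e : Θ ≅ fill H Δ} →
            ReachIntro F k d₂ → ReachIntro F (suc k) (⊙e d₁ H d₂ e)
  via-⊗e  : ∀ {k Θ Δ A B C H} {d₁ : Δ ⊢ A ⊗ B} {d₂ : fill H ([ A ] ,, [ B ]) ⊢ C}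
              {e : Θ ≅ fill H Δ} →
            ReachIntro F k d₂ → ReachIntro F (suc k) (⊗e d₁ H d₂ e)

-- ExtRedex k d : the last rule of d is an elimination rule whose major premise S₀
-- starts a k-extended-redex (path S₀,…,S_k in B(S₀) to an introduction, with
-- S₀ and S_k having the same right-hand formula).  For k = 0 these are the
-- introduction/elimination redexes.
data ExtRedex (k : ℕ) : ∀ {Θ C} → Θ ⊢ C → Set where
  r＼ : ∀ {Θ Γ Δ A C} {d₁ : Γ ⊢ A} {d₂ : Δ ⊢ A ＼ C} {e : Θ ≅ ⟨ Γ ⨾ Δ ⟩} →
        ReachIntro (A ＼ C) k d₂ → ExtRedex k (＼e d₁ d₂ e)
  r／ : ∀ {Θ Γ Δ A C} {d₁ : Δ ⊢ C ／ A} {d₂ : Γ ⊢ A} {e : Θ ≅ ⟨ Δ ⨾ Γ ⟩} →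
        ReachIntro (C ／ A) k d₁ → ExtRedex k (／e d₁ d₂ e)
  r⊸  : ∀ {Θ Γ Δ A C} {d₁ : Γ ⊢ A} {d₂ : Δ ⊢ A ⊸ C} {e : Θ ≅ (Γ ,, Δ)} →
        ReachIntro (A ⊸ C) k d₂ → ExtRedex k (⊸e d₁ d₂ e)
  r⊙  : ∀ {Θ Δ A B C H} {d₁ : Δ ⊢ A ⊙ B} {d₂ : fill H ⟨ [ A ] ⨾ [ B ] ⟩ ⊢ C}
          {e : Θ ≅ fill H Δ} →
        ReachIntro (A ⊙ B) k d₁ → ExtRedex k (⊙e d₁ H d₂ e)
  r⊗  : ∀ {Θ Δ A B C H} {d₁ : Δ ⊢ A ⊗ B} {d₂ : fill H ([ A ] ,, [ B ]) ⊢ C}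
          {e : Θ ≅ fill H Δ} →
        ReachIntro (A ⊗ B) k d₁ → ExtRedex k (⊗e d₁ H d₂ e)

-- The second kind of (0-)redex: a product elimination whose premise
-- ⟨A;B⟩ ⊢ A⊙B (resp. (A,B) ⊢ A⊗B) is concluded by the introduction from
-- the axioms A ⊢ A and B ⊢ B.
data AxProdRedex : ∀ {Θ C} → Θ ⊢ C → Set where
  ax⊙ : ∀ {Θ Δ A B H Ξ₁ Ξ₂} {d : Δ ⊢ A ⊙ B}
          {e₁ : Ξ₁ ≅ [ A ]} {e₂ : Ξ₂ ≅ [ B ]}
          {e₃ : fill H ⟨ [ A ] ⨾ [ B ] ⟩ ≅ ⟨ Ξ₁ ⨾ Ξ₂ ⟩} {e : Θ ≅ fill H Δ} →
        AxProdRedex (⊙e d H (⊙i (ax e₁) (ax e₂) e₃) e)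
  ax⊗ : ∀ {Θ Δ A B H Ξ₁ Ξ₂} {d : Δ ⊢ A ⊗ B}
          {e₁ : Ξ₁ ≅ [ A ]} {e₂ : Ξ₂ ≅ [ B ]}
          {e₃ : fill H ([ A ] ,, [ B ]) ≅ (Ξ₁ ,, Ξ₂)} {e : Θ ≅ fill H Δ} →
        AxProdRedex (⊗e d H (⊗i (ax e₁) (ax e₂) e₃) e)

RootRedex : ∀ {Θ C} → Θ ⊢ C → Set
RootRedex d = AxProdRedex d ⊎ Σ ℕ λ k → ExtRedex k d

data HasRedex : ∀ {Θ C} → Θ ⊢ C → Set where
  root   : ∀ {Θ C} {d : Θ ⊢ C} → RootRedex d → HasRedex d
  inside : ∀ {Θ C} {d : Θ ⊢ C} {p : AnyProof} →
           p ∈ premises d → HasRedex (proj₂ (proj₂ p)) → HasRedex d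

Normal : ∀ {Θ C} → Θ ⊢ C → Set
Normal d = ¬ HasRedex d

-- Normalisation by evaluation.  A formula C is interpreted as a family ⟦ C ⟧ of sets
-- indexed by contexts and antitone for the entropy order ≼ (a value in context Γ can
-- be used in any Θ ≼ Γ); implications are Kripke function spaces and a product is a
-- cover: a tree of product eliminations applied to neutral proofs, whose leaves are
-- pairs of values or neutral proofs.  Evaluating a proof in the environment that sends
-- each hypothesis to its reflected axiom and reifying the result yields a proof of the
-- same sequent in the shape of a neutral/normal term.  Along the principal branch of a
-- neutral proof only eliminations and entropy occur, so the major premise of a normal
-- elimination never reaches an introduction: there is no k-extended-redex for any k.

module Submission where

open import Defs
open import Data.Empty using (⊥)
open import Data.List.Relation.Unary.All as All using (All; []; _∷_)
open import Data.Product using (Σ; _×_; _,_; proj₁; proj₂)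
open import Data.Product.Function.Dependent.Propositional using (Σ-↔)
open import Data.Sum using (_⊎_; inj₁; inj₂)
open import Function using (_∘_)
open import Function.Bundles using (_↔_; Inverse; mk↔ₛ′)
open import Function.Construct.Composition using (_↔-∘_)
open import Function.Construct.Identity using (↔-id)
open import Function.Construct.Symmetry using (↔-sym)
open import Relation.Binary.PropositionalEquality
open import Relation.Nullary using (¬_)

open Inverse using (to; from; strictlyInverseˡ; strictlyInverseʳ)
open _≼_ using (bij)

≼-refl : ∀ {Γ} → Γ ≼ Γ
≼-refl = record { bij = ↔-id _ ; lab = λ _ → refl ; ord = λ _ _ p<q → p<q }

≼-trans : ∀ {Θ Γ Ξ} → Θ ≼ Γ → Γ ≼ Ξ → Θ ≼ Ξ
≼-trans r s = record
  { bij = bij s ↔-∘ bij r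
  ; lab = λ p → trans (_≼_.lab s _) (_≼_.lab r p)
  ; ord = λ p q p<q → _≼_.ord s _ _ (_≼_.ord r p q p<q)
  }

≡⇒≼ : ∀ {Θ Γ} → Θ ≡ Γ → Θ ≼ Γ
≡⇒≼ refl = ≼-refl

≅⇒≼ : ∀ {Θ Γ} → Θ ≅ Γ → Θ ≼ Γ
≅⇒≼ e = record { bij = _≅_.bij e ; lab = _≅_.lab e ; ord = _≅_.ord e }

≅-refl : ∀ {Γ} → Γ ≅ Γ
≅-refl = record
  { bij = ↔-id _ ; lab = λ _ → refl ; ord = λ _ _ p<q → p<q ; ord⁻ = λ _ _ p<q → p<q }

plug : (Θ : Ctx) → (Pos Θ → Ctx) → Ctx
plug ε         f = ε
plug [ A ]     f = f here
plug (Θ ,, Ξ)  f = plug Θ (f ∘ pl) ,, plug Ξ (f ∘ pr)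
plug ⟨ Θ ⨾ Ξ ⟩ f = ⟨ plug Θ (f ∘ sl) ⨾ plug Ξ (f ∘ sr) ⟩

plug-singletons : ∀ Γ → plug Γ (λ p → [ label p ]) ≡ Γ
plug-singletons ε         = refl
plug-singletons [ A ]     = refl
plug-singletons (Γ ,, Δ)  = cong₂ _,,_ (plug-singletons Γ) (plug-singletons Δ)
plug-singletons ⟨ Γ ⨾ Δ ⟩ = cong₂ ⟨_⨾_⟩ (plug-singletons Γ) (plug-singletons Δ)

module PlugPositions (Θ : Ctx) (f : Pos Θ → Ctx) where

  ΣPos : Set
  ΣPos = Σ (Pos Θ) (Pos ∘ f)

  data Lex : ΣPos → ΣPos → Set where
    outer : ∀ {p q x y} → Prec p q → Lex (p , x) (q , y)
    inner : ∀ {p x y} → Prec {f p} x y → Lex (p , x) (p , y)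

open PlugPositions using (ΣPos; Lex; outer; inner)

split-pos : ∀ Θ f → Pos (plug Θ f) → ΣPos Θ f
split-pos [ A ]     f x = here , x
split-pos (Θ ,, Ξ)  f (pl x) = let (p , y) = split-pos Θ (f ∘ pl) x in pl p , y
split-pos (Θ ,, Ξ)  f (pr x) = let (p , y) = split-pos Ξ (f ∘ pr) x in pr p , y
split-pos ⟨ Θ ⨾ Ξ ⟩ f (sl x) = let (p , y) = split-pos Θ (f ∘ sl) x in sl p , y
split-pos ⟨ Θ ⨾ Ξ ⟩ f (sr x) = let (p , y) = split-pos Ξ (f ∘ sr) x in sr p , y

join-pos : ∀ Θ f → ΣPos Θ f → Pos (plug Θ f)
join-pos [ A ]     f (here , y) = y
join-pos (Θ ,, Ξ)  f (pl p , y) = pl (join-pos Θ (f ∘ pl) (p , y))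
join-pos (Θ ,, Ξ)  f (pr p , y) = pr (join-pos Ξ (f ∘ pr) (p , y))
join-pos ⟨ Θ ⨾ Ξ ⟩ f (sl p , y) = sl (join-pos Θ (f ∘ sl) (p , y))
join-pos ⟨ Θ ⨾ Ξ ⟩ f (sr p , y) = sr (join-pos Ξ (f ∘ sr) (p , y))

split-join-pos : ∀ Θ f u → split-pos Θ f (join-pos Θ f u) ≡ u
split-join-pos [ A ]     f (here , y) = refl
split-join-pos (Θ ,, Ξ)  f (pl p , y) rewrite split-join-pos Θ (f ∘ pl) (p , y) = refl
split-join-pos (Θ ,, Ξ)  f (pr p , y) rewrite split-join-pos Ξ (f ∘ pr) (p , y) = refl
split-join-pos ⟨ Θ ⨾ Ξ ⟩ f (sl p , y) rewrite split-join-pos Θ (f ∘ sl) (p , y) = refl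
split-join-pos ⟨ Θ ⨾ Ξ ⟩ f (sr p , y) rewrite split-join-pos Ξ (f ∘ sr) (p , y) = refl

join-split-pos : ∀ Θ f x → join-pos Θ f (split-pos Θ f x) ≡ x
join-split-pos [ A ]     f x = refl
join-split-pos (Θ ,, Ξ)  f (pl x) = cong pl (join-split-pos Θ (f ∘ pl) x)
join-split-pos (Θ ,, Ξ)  f (pr x) = cong pr (join-split-pos Ξ (f ∘ pr) x)
join-split-pos ⟨ Θ ⨾ Ξ ⟩ f (sl x) = cong sl (join-split-pos Θ (f ∘ sl) x)
join-split-pos ⟨ Θ ⨾ Ξ ⟩ f (sr x) = cong sr (join-split-pos Ξ (f ∘ sr) x)

plug-Pos↔ΣPos : ∀ Θ f → Pos (plug Θ f) ↔ ΣPos Θ f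
plug-Pos↔ΣPos Θ f =
  mk↔ₛ′ (split-pos Θ f) (join-pos Θ f) (split-join-pos Θ f) (join-split-pos Θ f)

label-split-pos : ∀ Θ f x → label (proj₂ (split-pos Θ f x)) ≡ label x
label-split-pos [ A ]     f x = refl
label-split-pos (Θ ,, Ξ)  f (pl x) = label-split-pos Θ (f ∘ pl) x
label-split-pos (Θ ,, Ξ)  f (pr x) = label-split-pos Ξ (f ∘ pr) x
label-split-pos ⟨ Θ ⨾ Ξ ⟩ f (sl x) = label-split-pos Θ (f ∘ sl) x
label-split-pos ⟨ Θ ⨾ Ξ ⟩ f (sr x) = label-split-pos Ξ (f ∘ sr) x

label-join-pos : ∀ Θ f u → label (join-pos Θ f u) ≡ label (proj₂ u)
label-join-pos Θ f u = begin
  label (join-pos Θ f u)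
    ≡⟨ label-split-pos Θ f (join-pos Θ f u) ⟨
  label (proj₂ (split-pos Θ f (join-pos Θ f u)))
    ≡⟨ cong (λ v → label (proj₂ v)) (split-join-pos Θ f u) ⟩
  label (proj₂ u)
    ∎
  where open ≡-Reasoning

split-pos-Prec : ∀ Θ f x y → Prec x y → Lex Θ f (split-pos Θ f x) (split-pos Θ f y)
split-pos-Prec [ A ] f x y x<y = inner x<y
split-pos-Prec (Θ ,, Ξ) f (pl x) (pl y) (pl-pl x<y)
  with split-pos Θ (f ∘ pl) x | split-pos Θ (f ∘ pl) y | split-pos-Prec Θ (f ∘ pl) x y x<y
... | _ | _ | outer p<q = outer (pl-pl p<q)
... | _ | _ | inner u<v = inner u<v
split-pos-Prec (Θ ,, Ξ) f (pr x) (pr y) (pr-pr x<y)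
  with split-pos Ξ (f ∘ pr) x | split-pos Ξ (f ∘ pr) y | split-pos-Prec Ξ (f ∘ pr) x y x<y
... | _ | _ | outer p<q = outer (pr-pr p<q)
... | _ | _ | inner u<v = inner u<v
split-pos-Prec ⟨ Θ ⨾ Ξ ⟩ f (sl x) (sl y) (sl-sl x<y)
  with split-pos Θ (f ∘ sl) x | split-pos Θ (f ∘ sl) y | split-pos-Prec Θ (f ∘ sl) x y x<y
... | _ | _ | outer p<q = outer (sl-sl p<q)
... | _ | _ | inner u<v = inner u<v
split-pos-Prec ⟨ Θ ⨾ Ξ ⟩ f (sr x) (sr y) (sr-sr x<y)
  with split-pos Ξ (f ∘ sr) x | split-pos Ξ (f ∘ sr) y | split-pos-Prec Ξ (f ∘ sr) x y x<y
... | _ | _ | outer p<q = outer (sr-sr p<q)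
... | _ | _ | inner u<v = inner u<v
split-pos-Prec ⟨ Θ ⨾ Ξ ⟩ f (sl x) (sr y) sl-sr = outer sl-sr

join-pos-Prec : ∀ Θ f u v → Lex Θ f u v → Prec (join-pos Θ f u) (join-pos Θ f v)
join-pos-Prec [ A ] f (here , x) (here , y) (inner x<y) = x<y
join-pos-Prec (Θ ,, Ξ) f (pl p , x) (pl q , y) (outer (pl-pl p<q)) =
  pl-pl (join-pos-Prec Θ (f ∘ pl) _ _ (outer p<q))
join-pos-Prec (Θ ,, Ξ) f (pl p , x) (pl p , y) (inner x<y) =
  pl-pl (join-pos-Prec Θ (f ∘ pl) _ _ (inner x<y))
join-pos-Prec (Θ ,, Ξ) f (pr p , x) (pr q , y) (outer (pr-pr p<q)) =
  pr-pr (join-pos-Prec Ξ (f ∘ pr) _ _ (outer p<q))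
join-pos-Prec (Θ ,, Ξ) f (pr p , x) (pr p , y) (inner x<y) =
  pr-pr (join-pos-Prec Ξ (f ∘ pr) _ _ (inner x<y))
join-pos-Prec ⟨ Θ ⨾ Ξ ⟩ f (sl p , x) (sl q , y) (outer (sl-sl p<q)) =
  sl-sl (join-pos-Prec Θ (f ∘ sl) _ _ (outer p<q))
join-pos-Prec ⟨ Θ ⨾ Ξ ⟩ f (sl p , x) (sl p , y) (inner x<y) =
  sl-sl (join-pos-Prec Θ (f ∘ sl) _ _ (inner x<y))
join-pos-Prec ⟨ Θ ⨾ Ξ ⟩ f (sr p , x) (sr q , y) (outer (sr-sr p<q)) =
  sr-sr (join-pos-Prec Ξ (f ∘ sr) _ _ (outer p<q))
join-pos-Prec ⟨ Θ ⨾ Ξ ⟩ f (sr p , x) (sr p , y) (inner x<y) =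
  sr-sr (join-pos-Prec Ξ (f ∘ sr) _ _ (inner x<y))
join-pos-Prec ⟨ Θ ⨾ Ξ ⟩ f (sl p , x) (sr q , y) (outer sl-sr) = sl-sr

plug-mono-≼ : ∀ {Θ Θ′} {f : Pos Θ → Ctx} {g : Pos Θ′ → Ctx} (b : Θ ≼ Θ′) →
              (∀ p → f p ≼ g (to (bij b) p)) → plug Θ f ≼ plug Θ′ g
plug-mono-≼ {Θ} {Θ′} {f} {g} b f≼g = record
  { bij = ↔-sym (plug-Pos↔ΣPos Θ′ g) ↔-∘ (Σ↔ ↔-∘ plug-Pos↔ΣPos Θ f)
  ; lab = λ x → trans (label-join-pos Θ′ g _)
                  (trans (_≼_.lab (f≼g (proj₁ (split-pos Θ f x))) _) (label-split-pos Θ f x))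
  ; ord = λ x y x<y → join-pos-Prec Θ′ g _ _ (Σ↔-Lex _ _ (split-pos-Prec Θ f x y x<y))
  }
  where
  Σ↔ : ΣPos Θ f ↔ ΣPos Θ′ g
  Σ↔ = Σ-↔ (bij b) (λ {p} → bij (f≼g p))

  Σ↔-Lex : ∀ u v → Lex Θ f u v → Lex Θ′ g (to Σ↔ u) (to Σ↔ v)
  Σ↔-Lex _ _ (outer p<q)     = outer (_≼_.ord b _ _ p<q)
  Σ↔-Lex _ _ (inner {p} x<y) = inner (_≼_.ord (f≼g p) _ _ x<y)

plug-reindex-≼ : ∀ {Θ Θ′} {f : Pos Θ → Ctx} (b : Θ ≼ Θ′) →
                 plug Θ f ≼ plug Θ′ (f ∘ from (bij b))
plug-reindex-≼ {f = f} b =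
  plug-mono-≼ b (λ p → ≡⇒≼ (cong f (sym (strictlyInverseʳ (bij b) p))))

-- (Θ₁ ,, Θ₂) and ⟨ Θ₁ ⨾ Θ₂ ⟩ are Θ₁ and Θ₂ plugged into a two-element context.

,,-mono-≼ : ∀ {Θ₁ Θ₂ Γ₁ Γ₂} → Θ₁ ≼ Γ₁ → Θ₂ ≼ Γ₂ → (Θ₁ ,, Θ₂) ≼ (Γ₁ ,, Γ₂)
,,-mono-≼ {Θ₁} {Θ₂} {Γ₁} {Γ₂} r s =
  plug-mono-≼ {Θ = [ var 0 ] ,, [ var 0 ]}
    {f = λ { (pl here) → Θ₁ ; (pr here) → Θ₂ }} {g = λ { (pl here) → Γ₁ ; (pr here) → Γ₂ }}
    ≼-refl (λ { (pl here) → r ; (pr here) → s })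

⨾-mono-≼ : ∀ {Θ₁ Θ₂ Γ₁ Γ₂} → Θ₁ ≼ Γ₁ → Θ₂ ≼ Γ₂ → ⟨ Θ₁ ⨾ Θ₂ ⟩ ≼ ⟨ Γ₁ ⨾ Γ₂ ⟩
⨾-mono-≼ {Θ₁} {Θ₂} {Γ₁} {Γ₂} r s =
  plug-mono-≼ {Θ = ⟨ [ var 0 ] ⨾ [ var 0 ] ⟩}
    {f = λ { (sl here) → Θ₁ ; (sr here) → Θ₂ }} {g = λ { (sl here) → Γ₁ ; (sr here) → Γ₂ }}
    ≼-refl (λ { (sl here) → r ; (sr here) → s })

fill-mono-≼ : ∀ (H : HCtx) {Θ Γ} → Θ ≼ Γ → fill H Θ ≼ fill H Γ
fill-mono-≼ hole       r = r
fill-mono-≼ (parL H Γ) r = ,,-mono-≼ (fill-mono-≼ H r) ≼-refl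
fill-mono-≼ (parR Γ H) r = ,,-mono-≼ ≼-refl (fill-mono-≼ H r)
fill-mono-≼ (serL H Γ) r = ⨾-mono-≼ (fill-mono-≼ H r) ≼-refl
fill-mono-≼ (serR Γ H) r = ⨾-mono-≼ ≼-refl (fill-mono-≼ H r)

_∘ₕ_ : HCtx → HCtx → HCtx
hole     ∘ₕ K = K
parL H Γ ∘ₕ K = parL (H ∘ₕ K) Γ
parR Γ H ∘ₕ K = parR Γ (H ∘ₕ K)
serL H Γ ∘ₕ K = serL (H ∘ₕ K) Γ
serR Γ H ∘ₕ K = serR Γ (H ∘ₕ K)

fill-∘ₕ : ∀ H K X → fill H (fill K X) ≡ fill (H ∘ₕ K) X
fill-∘ₕ hole       K X = refl
fill-∘ₕ (parL H Γ) K X = cong (_,, Γ) (fill-∘ₕ H K X)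
fill-∘ₕ (parR Γ H) K X = cong (Γ ,,_) (fill-∘ₕ H K X)
fill-∘ₕ (serL H Γ) K X = cong ⟨_⨾ Γ ⟩ (fill-∘ₕ H K X)
fill-∘ₕ (serR Γ H) K X = cong ⟨ Γ ⨾_⟩ (fill-∘ₕ H K X)

OPos : HCtx → Set
OPos hole       = ⊥
OPos (parL H Γ) = OPos H ⊎ Pos Γ
OPos (parR Γ H) = Pos Γ ⊎ OPos H
OPos (serL H Γ) = OPos H ⊎ Pos Γ
OPos (serR Γ H) = Pos Γ ⊎ OPos H

olabel : ∀ H → OPos H → Formula
olabel (parL H Γ) (inj₁ o) = olabel H o
olabel (parL H Γ) (inj₂ p) = label p
olabel (parR Γ H) (inj₁ p) = label p
olabel (parR Γ H) (inj₂ o) = olabel H o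
olabel (serL H Γ) (inj₁ o) = olabel H o
olabel (serL H Γ) (inj₂ p) = label p
olabel (serR Γ H) (inj₁ p) = label p
olabel (serR Γ H) (inj₂ o) = olabel H o

plugH : (H : HCtx) → (OPos H → Ctx) → HCtx
plugH hole       g = hole
plugH (parL H Γ) g = parL (plugH H (g ∘ inj₁)) (plug Γ (g ∘ inj₂))
plugH (parR Γ H) g = parR (plug Γ (g ∘ inj₁)) (plugH H (g ∘ inj₂))
plugH (serL H Γ) g = serL (plugH H (g ∘ inj₁)) (plug Γ (g ∘ inj₂))
plugH (serR Γ H) g = serR (plug Γ (g ∘ inj₁)) (plugH H (g ∘ inj₂))

module Environments (V : Formula → Ctx → Set) where

  Env : Ctx → Set
  Env Θ = (p : Pos Θ) → Σ Ctx (V (label p))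

  OEnv : HCtx → Set
  OEnv H = (o : OPos H) → Σ Ctx (V (olabel H o))

  ctxs : ∀ {Θ} → Env Θ → Pos Θ → Ctx
  ctxs a p = proj₁ (a p)

  outside : ∀ H {X} → Env (fill H X) → OEnv H
  outside (parL H Γ) a (inj₁ o) = outside H (a ∘ pl) o
  outside (parL H Γ) a (inj₂ p) = a (pr p)
  outside (parR Γ H) a (inj₁ p) = a (pl p)
  outside (parR Γ H) a (inj₂ o) = outside H (a ∘ pr) o
  outside (serL H Γ) a (inj₁ o) = outside H (a ∘ sl) o
  outside (serL H Γ) a (inj₂ p) = a (sr p)
  outside (serR Γ H) a (inj₁ p) = a (sl p)
  outside (serR Γ H) a (inj₂ o) = outside H (a ∘ sr) o

  inHole : ∀ H {X} → Env (fill H X) → Env X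
  inHole hole       a = a
  inHole (parL H Γ) a = inHole H (a ∘ pl)
  inHole (parR Γ H) a = inHole H (a ∘ pr)
  inHole (serL H Γ) a = inHole H (a ∘ sl)
  inHole (serR Γ H) a = inHole H (a ∘ sr)

  fillEnv : ∀ H {X} → OEnv H → Env X → Env (fill H X)
  fillEnv hole       o i p      = i p
  fillEnv (parL H Γ) o i (pl p) = fillEnv H (o ∘ inj₁) i p
  fillEnv (parL H Γ) o i (pr p) = o (inj₂ p)
  fillEnv (parR Γ H) o i (pl p) = o (inj₁ p)
  fillEnv (parR Γ H) o i (pr p) = fillEnv H (o ∘ inj₂) i p
  fillEnv (serL H Γ) o i (sl p) = fillEnv H (o ∘ inj₁) i p
  fillEnv (serL H Γ) o i (sr p) = o (inj₂ p)
  fillEnv (serR Γ H) o i (sl p) = o (inj₁ p)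
  fillEnv (serR Γ H) o i (sr p) = fillEnv H (o ∘ inj₂) i p

  plug-fill-split : ∀ H {X} (a : Env (fill H X)) →
    plug (fill H X) (ctxs a) ≡ fill (plugH H (proj₁ ∘ outside H a)) (plug X (ctxs (inHole H a)))
  plug-fill-split hole       a = refl
  plug-fill-split (parL H Γ) a = cong₂ _,,_ (plug-fill-split H (a ∘ pl)) refl
  plug-fill-split (parR Γ H) a = cong₂ _,,_ refl (plug-fill-split H (a ∘ pr))
  plug-fill-split (serL H Γ) a = cong₂ ⟨_⨾_⟩ (plug-fill-split H (a ∘ sl)) refl
  plug-fill-split (serR Γ H) a = cong₂ ⟨_⨾_⟩ refl (plug-fill-split H (a ∘ sr))

  plug-fillEnv : ∀ H {X} (o : OEnv H) (i : Env X) →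
    plug (fill H X) (ctxs (fillEnv H o i)) ≡ fill (plugH H (proj₁ ∘ o)) (plug X (ctxs i))
  plug-fillEnv hole       o i = refl
  plug-fillEnv (parL H Γ) o i = cong₂ _,,_ (plug-fillEnv H (o ∘ inj₁) i) refl
  plug-fillEnv (parR Γ H) o i = cong₂ _,,_ refl (plug-fillEnv H (o ∘ inj₂) i)
  plug-fillEnv (serL H Γ) o i = cong₂ ⟨_⨾_⟩ (plug-fillEnv H (o ∘ inj₁) i) refl
  plug-fillEnv (serR Γ H) o i = cong₂ ⟨_⨾_⟩ refl (plug-fillEnv H (o ∘ inj₂) i)

  reindex : ∀ {Θ Θ′} (b : Θ ≼ Θ′) → Env Θ → Env Θ′
  reindex b a q = proj₁ (a (from (bij b) q)) ,
    subst (λ F → V F _)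
      (trans (sym (_≼_.lab b _)) (cong label (strictlyInverseˡ (bij b) q)))
      (proj₂ (a (from (bij b) q)))

  plug-reindex : ∀ {Θ Θ′} (b : Θ ≼ Θ′) (a : Env Θ) →
                 plug Θ (ctxs a) ≼ plug Θ′ (ctxs (reindex b a))
  plug-reindex b a = plug-reindex-≼ b

data IsNe : ∀ {Θ C} → Θ ⊢ C → Set
data IsNf : ∀ {Θ C} → Θ ⊢ C → Set

data IsNe where
  ne-ax  : ∀ {Θ A} {e : Θ ≅ [ A ]} → IsNe (ax e)
  ne-ent : ∀ {Θ Γ C} {d : Γ ⊢ C} {r : Θ ≼ Γ} → IsNe d → IsNe (ent d r)
  ne-＼e : ∀ {Θ Γ Δ A C} {d₁ : Γ ⊢ A} {d₂ : Δ ⊢ A ＼ C} {e : Θ ≅ ⟨ Γ ⨾ Δ ⟩} →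
           IsNf d₁ → IsNe d₂ → IsNe (＼e d₁ d₂ e)
  ne-／e : ∀ {Θ Γ Δ A C} {d₁ : Δ ⊢ C ／ A} {d₂ : Γ ⊢ A} {e : Θ ≅ ⟨ Δ ⨾ Γ ⟩} →
           IsNe d₁ → IsNf d₂ → IsNe (／e d₁ d₂ e)
  ne-⊸e  : ∀ {Θ Γ Δ A C} {d₁ : Γ ⊢ A} {d₂ : Δ ⊢ A ⊸ C} {e : Θ ≅ (Γ ,, Δ)} →
           IsNf d₁ → IsNe d₂ → IsNe (⊸e d₁ d₂ e)

-- The premises of a product introduction are entropy steps, so the minor premise of
-- a normal product elimination is never the introduction from two axioms.
data IsNf where
  nf-ne  : ∀ {Θ C} {d : Θ ⊢ C} → IsNe d → IsNf d
  nf-ent : ∀ {Θ Γ C} {d : Γ ⊢ C} {r : Θ ≼ Γ} → IsNf d → IsNf (ent d r)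
  nf-＼i : ∀ {Θ Γ A C} {d : ⟨ [ A ] ⨾ Γ ⟩ ⊢ C} {e : Θ ≅ Γ} → IsNf d → IsNf (＼i d e)
  nf-／i : ∀ {Θ Γ A C} {d : ⟨ Γ ⨾ [ A ] ⟩ ⊢ C} {e : Θ ≅ Γ} → IsNf d → IsNf (／i d e)
  nf-⊸i  : ∀ {Θ Γ A C} {d : ([ A ] ,, Γ) ⊢ C} {e : Θ ≅ Γ} → IsNf d → IsNf (⊸i d e)
  nf-⊙i  : ∀ {Θ Γ Γ′ Δ Δ′ A B} {d₁ : Δ′ ⊢ A} {d₂ : Γ′ ⊢ B} {r₁ : Δ ≼ Δ′} {r₂ : Γ ≼ Γ′}
             {e : Θ ≅ ⟨ Δ ⨾ Γ ⟩} → IsNf d₁ → IsNf d₂ → IsNf (⊙i (ent d₁ r₁) (ent d₂ r₂) e)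
  nf-⊗i  : ∀ {Θ Γ Γ′ Δ Δ′ A B} {d₁ : Δ′ ⊢ A} {d₂ : Γ′ ⊢ B} {r₁ : Δ ≼ Δ′} {r₂ : Γ ≼ Γ′}
             {e : Θ ≅ (Δ ,, Γ)} → IsNf d₁ → IsNf d₂ → IsNf (⊗i (ent d₁ r₁) (ent d₂ r₂) e)
  nf-⊙e  : ∀ {Θ Δ A B C H} {d₁ : Δ ⊢ A ⊙ B} {d₂ : fill H ⟨ [ A ] ⨾ [ B ] ⟩ ⊢ C}
             {e : Θ ≅ fill H Δ} → IsNe d₁ → IsNf d₂ → IsNf (⊙e d₁ H d₂ e)
  nf-⊗e  : ∀ {Θ Δ A B C H} {d₁ : Δ ⊢ A ⊗ B} {d₂ : fill H ([ A ] ,, [ B ]) ⊢ C}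
             {e : Θ ≅ fill H Δ} → IsNe d₁ → IsNf d₂ → IsNf (⊗e d₁ H d₂ e)

ne⇒¬ReachIntro : ∀ {F k Θ C} {d : Θ ⊢ C} → IsNe d → ReachIntro F k d → ⊥
ne⇒¬ReachIntro ne-ax        (stop ())
ne⇒¬ReachIntro (ne-ent n)   (stop ())
ne⇒¬ReachIntro (ne-ent n)   (via-ent ρ) = ne⇒¬ReachIntro n ρ
ne⇒¬ReachIntro (ne-＼e _ n) (stop ())
ne⇒¬ReachIntro (ne-＼e _ n) (via-＼e ρ) = ne⇒¬ReachIntro n ρ
ne⇒¬ReachIntro (ne-／e n _) (stop ())
ne⇒¬ReachIntro (ne-／e n _) (via-／e ρ) = ne⇒¬ReachIntro n ρ
ne⇒¬ReachIntro (ne-⊸e _ n)  (stop ())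
ne⇒¬ReachIntro (ne-⊸e _ n)  (via-⊸e ρ) = ne⇒¬ReachIntro n ρ

¬AxProdRedex-⊙e : ∀ {Θ Δ A B C H} {d₁ : Δ ⊢ A ⊙ B} {d₂ : fill H ⟨ [ A ] ⨾ [ B ] ⟩ ⊢ C}
                    {e : Θ ≅ fill H Δ} → IsNf d₂ → ¬ AxProdRedex (⊙e d₁ H d₂ e)
¬AxProdRedex-⊙e (nf-ne ()) ax⊙

¬AxProdRedex-⊗e : ∀ {Θ Δ A B C H} {d₁ : Δ ⊢ A ⊗ B} {d₂ : fill H ([ A ] ,, [ B ]) ⊢ C}
                    {e : Θ ≅ fill H Δ} → IsNf d₂ → ¬ AxProdRedex (⊗e d₁ H d₂ e)
¬AxProdRedex-⊗e (nf-ne ()) ax⊗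

PremisesNormal : ∀ {Θ C} → Θ ⊢ C → Set
PremisesNormal d = All (λ p → Normal (proj₂ (proj₂ p))) (premises d)

normal-from-premises : ∀ {Θ C} {d : Θ ⊢ C} →
                       ¬ RootRedex d → PremisesNormal d → Normal d
normal-from-premises ¬root _  (root ρ)      = ¬root ρ
normal-from-premises _     ns (inside p∈ h) = All.lookup ns p∈ h

ne⇒Normal : ∀ {Θ C} {d : Θ ⊢ C} → IsNe d → Normal d
nf⇒Normal : ∀ {Θ C} {d : Θ ⊢ C} → IsNf d → Normal d

ne⇒Normal ne-ax = normal-from-premises (λ { (inj₁ ()) ; (inj₂ (_ , ())) }) []
ne⇒Normal (ne-ent n) =
  normal-from-premises (λ { (inj₁ ()) ; (inj₂ (_ , ())) }) (ne⇒Normal n ∷ [])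
ne⇒Normal (ne-＼e m n) =
  normal-from-premises (λ { (inj₁ ()) ; (inj₂ (_ , r＼ ρ)) → ne⇒¬ReachIntro n ρ })
    (nf⇒Normal m ∷ ne⇒Normal n ∷ [])
ne⇒Normal (ne-／e n m) =
  normal-from-premises (λ { (inj₁ ()) ; (inj₂ (_ , r／ ρ)) → ne⇒¬ReachIntro n ρ })
    (ne⇒Normal n ∷ nf⇒Normal m ∷ [])
ne⇒Normal (ne-⊸e m n) =
  normal-from-premises (λ { (inj₁ ()) ; (inj₂ (_ , r⊸ ρ)) → ne⇒¬ReachIntro n ρ })
    (nf⇒Normal m ∷ ne⇒Normal n ∷ [])

nf⇒Normal (nf-ne n) = ne⇒Normal n
nf⇒Normal (nf-ent n) =
  normal-from-premises (λ { (inj₁ ()) ; (inj₂ (_ , ())) }) (nf⇒Normal n ∷ [])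
nf⇒Normal (nf-＼i n) =
  normal-from-premises (λ { (inj₁ ()) ; (inj₂ (_ , ())) }) (nf⇒Normal n ∷ [])
nf⇒Normal (nf-／i n) =
  normal-from-premises (λ { (inj₁ ()) ; (inj₂ (_ , ())) }) (nf⇒Normal n ∷ [])
nf⇒Normal (nf-⊸i n) =
  normal-from-premises (λ { (inj₁ ()) ; (inj₂ (_ , ())) }) (nf⇒Normal n ∷ [])
nf⇒Normal (nf-⊙i m n) =
  normal-from-premises (λ { (inj₁ ()) ; (inj₂ (_ , ())) })
    (nf⇒Normal (nf-ent m) ∷ nf⇒Normal (nf-ent n) ∷ [])
nf⇒Normal (nf-⊗i m n) =
  normal-from-premises (λ { (inj₁ ()) ; (inj₂ (_ , ())) })
    (nf⇒Normal (nf-ent m) ∷ nf⇒Normal (nf-ent n) ∷ [])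
nf⇒Normal (nf-⊙e n m) =
  normal-from-premises
    (λ { (inj₁ ρ) → ¬AxProdRedex-⊙e m ρ ; (inj₂ (_ , r⊙ ρ)) → ne⇒¬ReachIntro n ρ })
    (ne⇒Normal n ∷ nf⇒Normal m ∷ [])
nf⇒Normal (nf-⊗e n m) =
  normal-from-premises
    (λ { (inj₁ ρ) → ¬AxProdRedex-⊗e m ρ ; (inj₂ (_ , r⊗ ρ)) → ne⇒¬ReachIntro n ρ })
    (ne⇒Normal n ∷ nf⇒Normal m ∷ [])

data Product : Set where
  ser par : Product

prod : Product → Formula → Formula → Formula
prod ser = _⊙_
prod par = _⊗_

pair : Product → Ctx → Ctx → Ctx
pair ser = ⟨_⨾_⟩
pair par = _,,_

prodI : ∀ κ {Θ Γ Δ A B} → Δ ⊢ A → Γ ⊢ B → Θ ≅ pair κ Δ Γ → Θ ⊢ prod κ A B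
prodI ser = ⊙i
prodI par = ⊗i

prodE : ∀ κ {Θ Δ A B C} → Δ ⊢ prod κ A B → (H : HCtx) →
        fill H (pair κ [ A ] [ B ]) ⊢ C → Θ ≅ fill H Δ → Θ ⊢ C
prodE ser = ⊙e
prodE par = ⊗e

nf-prodI : ∀ κ {Θ Γ Γ′ Δ Δ′ A B} {d₁ : Δ′ ⊢ A} {d₂ : Γ′ ⊢ B} {r₁ : Δ ≼ Δ′} {r₂ : Γ ≼ Γ′}
             {e : Θ ≅ pair κ Δ Γ} → IsNf d₁ → IsNf d₂ → IsNf (prodI κ (ent d₁ r₁) (ent d₂ r₂) e)
nf-prodI ser = nf-⊙i
nf-prodI par = nf-⊗i

nf-prodE : ∀ κ {Θ Δ A B C H} {d₁ : Δ ⊢ prod κ A B} {d₂ : fill H (pair κ [ A ] [ B ]) ⊢ C}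
             {e : Θ ≅ fill H Δ} → IsNe d₁ → IsNf d₂ → IsNf (prodE κ d₁ H d₂ e)
nf-prodE ser = nf-⊙e
nf-prodE par = nf-⊗e

Nf : Ctx → Formula → Set
Nf Γ C = Σ (Γ ⊢ C) IsNf

Ne : Ctx → Formula → Set
Ne Γ C = Σ (Γ ⊢ C) IsNe

data Cover (P : Ctx → Set) : Ctx → Set where
  leaf  : ∀ {Θ Γ} → Θ ≼ Γ → P Γ → Cover P Θ
  split : ∀ κ {Θ Δ X Y} (H : HCtx) → Ne Δ (prod κ X Y) →
          Cover P (fill H (pair κ [ X ] [ Y ])) → Θ ≼ fill H Δ → Cover P Θ

⟦_⟧ : Formula → Ctx → Set
Pair : Product → Formula → Formula → Ctx → Set

⟦ var n ⟧ Γ = Nf Γ (var n)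
⟦ A ⊗ B ⟧   = Cover (Pair par A B)
⟦ A ⊙ B ⟧   = Cover (Pair ser A B)
⟦ A ⊸ C ⟧ Δ = ∀ {Δ′} → Δ′ ≼ Δ → ∀ {Γ} → ⟦ A ⟧ Γ → ⟦ C ⟧ (Γ ,, Δ′)
⟦ A ＼ C ⟧ Δ = ∀ {Δ′} → Δ′ ≼ Δ → ∀ {Γ} → ⟦ A ⟧ Γ → ⟦ C ⟧ ⟨ Γ ⨾ Δ′ ⟩
⟦ C ／ A ⟧ Δ = ∀ {Δ′} → Δ′ ≼ Δ → ∀ {Γ} → ⟦ A ⟧ Γ → ⟦ C ⟧ ⟨ Δ′ ⨾ Γ ⟩

Pair κ A B Γ =
  (Σ Ctx λ Γ₁ → Σ Ctx λ Γ₂ → ⟦ A ⟧ Γ₁ × ⟦ B ⟧ Γ₂ × Γ ≼ pair κ Γ₁ Γ₂) ⊎ Ne Γ (prod κ A B)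

Cover-mono : ∀ {P Θ Γ} → Θ ≼ Γ → Cover P Γ → Cover P Θ
Cover-mono r (leaf s p)        = leaf (≼-trans r s) p
Cover-mono r (split κ H n c s) = split κ H n c (≼-trans r s)

⟦⟧-mono : ∀ C {Θ Γ} → Θ ≼ Γ → ⟦ C ⟧ Γ → ⟦ C ⟧ Θ
⟦⟧-mono (var n) r (d , nd) = ent d r , nf-ent nd
⟦⟧-mono (A ⊗ B) r c = Cover-mono r c
⟦⟧-mono (A ⊙ B) r c = Cover-mono r c
⟦⟧-mono (A ⊸ C) r f = λ r′ → f (≼-trans r′ r)
⟦⟧-mono (A ＼ C) r f = λ r′ → f (≼-trans r′ r)
⟦⟧-mono (C ／ A) r f = λ r′ → f (≼-trans r′ r)

Cover-bind-fill : ∀ {P Q : Ctx → Set} (K : HCtx) → (∀ {D} → P D → Cover Q (fill K D)) →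
                  ∀ {D} → Cover P D → Cover Q (fill K D)
Cover-bind-fill K k (leaf s p) = Cover-mono (fill-mono-≼ K s) (k p)
Cover-bind-fill {Q = Q} K k (split κ {Δ = Δ} H n c s) =
  split κ (K ∘ₕ H) n (subst (Cover Q) (fill-∘ₕ K H _) (Cover-bind-fill K k c))
        (subst (_ ≼_) (fill-∘ₕ K H Δ) (fill-mono-≼ K s))

Cover-join : ∀ {P Γ} → Cover (Cover P) Γ → Cover P Γ
Cover-join (leaf s c)        = Cover-mono s c
Cover-join (split κ H n c s) = split κ H n (Cover-join c) s

-- Every ⟦ C ⟧ is closed under covers; at an atom the pending eliminations are
-- performed syntactically.
⟦⟧-collapse : ∀ C {Γ} → Cover ⟦ C ⟧ Γ → ⟦ C ⟧ Γ
⟦⟧-collapse (var n) (leaf s x) = ⟦⟧-mono (var n) s x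
⟦⟧-collapse (var n) (split κ H (d , nd) c s) =
  let (m , nm) = ⟦⟧-collapse (var n) c in ent (prodE κ d H m ≅-refl) s , nf-ent (nf-prodE κ nd nm)
⟦⟧-collapse (A ⊗ B) c = Cover-join c
⟦⟧-collapse (A ⊙ B) c = Cover-join c
⟦⟧-collapse (A ⊸ C) c r {Γ} a =
  ⟦⟧-collapse C (Cover-bind-fill (parR Γ hole) (λ f → leaf ≼-refl (f ≼-refl a)) (Cover-mono r c))
⟦⟧-collapse (A ＼ C) c r {Γ} a =
  ⟦⟧-collapse C (Cover-bind-fill (serR Γ hole) (λ f → leaf ≼-refl (f ≼-refl a)) (Cover-mono r c))
⟦⟧-collapse (C ／ A) c r {Γ} a =
  ⟦⟧-collapse C (Cover-bind-fill (serL hole Γ) (λ f → leaf ≼-refl (f ≼-refl a)) (Cover-mono r c))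

reflect : ∀ C {Γ} → Ne Γ C → ⟦ C ⟧ Γ
reify : ∀ C {Γ} → ⟦ C ⟧ Γ → Nf Γ C
reify-prod : ∀ κ A B {Γ} → Cover (Pair κ A B) Γ → Nf Γ (prod κ A B)

⟦⟧-axiom : ∀ A → ⟦ A ⟧ [ A ]
⟦⟧-axiom A = reflect A (ax ≅-refl , ne-ax)

reflect (var n) (d , nd) = d , nf-ne nd
reflect (A ⊗ B) n = leaf ≼-refl (inj₂ n)
reflect (A ⊙ B) n = leaf ≼-refl (inj₂ n)
reflect (A ⊸ C) (d , nd) r a =
  let (m , nm) = reify A a in reflect C (⊸e m (ent d r) ≅-refl , ne-⊸e nm (ne-ent nd))
reflect (A ＼ C) (d , nd) r a =
  let (m , nm) = reify A a in reflect C (＼e m (ent d r) ≅-refl , ne-＼e nm (ne-ent nd))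
reflect (C ／ A) (d , nd) r a =
  let (m , nm) = reify A a in reflect C (／e (ent d r) m ≅-refl , ne-／e (ne-ent nd) nm)

reify (var n) x = x
reify (A ⊗ B) c = reify-prod par A B c
reify (A ⊙ B) c = reify-prod ser A B c
reify (A ⊸ C) f = let (d , nd) = reify C (f ≼-refl (⟦⟧-axiom A)) in ⊸i d ≅-refl , nf-⊸i nd
reify (A ＼ C) f = let (d , nd) = reify C (f ≼-refl (⟦⟧-axiom A)) in ＼i d ≅-refl , nf-＼i nd
reify (C ／ A) f = let (d , nd) = reify C (f ≼-refl (⟦⟧-axiom A)) in ／i d ≅-refl , nf-／i nd

reify-prod κ A B (leaf s (inj₁ (_ , _ , a , b , s′))) =
  let (d₁ , n₁) = reify A a ; (d₂ , n₂) = reify B b in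
  ent (prodI κ (ent d₁ ≼-refl) (ent d₂ ≼-refl) ≅-refl) (≼-trans s s′) , nf-ent (nf-prodI κ n₁ n₂)
reify-prod κ A B (leaf s (inj₂ (d , nd))) = ent d s , nf-ent (nf-ne nd)
reify-prod κ A B (split κ′ H (d , nd) c s) =
  let (m , nm) = reify-prod κ A B c in ent (prodE κ′ d H m ≅-refl) s , nf-ent (nf-prodE κ′ nd nm)

open Environments ⟦_⟧

extend-⨾ˡ : ∀ {A Γ Ξ} → ⟦ A ⟧ Ξ → Env Γ → Env ⟨ [ A ] ⨾ Γ ⟩
extend-⨾ˡ x a (sl here) = _ , x
extend-⨾ˡ x a (sr p)    = a p

extend-⨾ʳ : ∀ {A Γ Ξ} → ⟦ A ⟧ Ξ → Env Γ → Env ⟨ Γ ⨾ [ A ] ⟩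
extend-⨾ʳ x a (sr here) = _ , x
extend-⨾ʳ x a (sl p)    = a p

extend-,, : ∀ {A Γ Ξ} → ⟦ A ⟧ Ξ → Env Γ → Env ([ A ] ,, Γ)
extend-,, x a (pl here) = _ , x
extend-,, x a (pr p)    = a p

pairEnv : ∀ κ {A B Γ₁ Γ₂} → ⟦ A ⟧ Γ₁ → ⟦ B ⟧ Γ₂ → Env (pair κ [ A ] [ B ])
pairEnv ser x y (sl here) = _ , x
pairEnv ser x y (sr here) = _ , y
pairEnv par x y (pl here) = _ , x
pairEnv par x y (pr here) = _ , y

plug-pairEnv : ∀ κ {A B Γ₁ Γ₂} (x : ⟦ A ⟧ Γ₁) (y : ⟦ B ⟧ Γ₂) →
               plug (pair κ [ A ] [ B ]) (ctxs (pairEnv κ x y)) ≡ pair κ Γ₁ Γ₂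
plug-pairEnv ser x y = refl
plug-pairEnv par x y = refl

eval-via : ∀ C {Θ Γ} (r : Θ ≼ Γ) (a : Env Θ) →
           ((a′ : Env Γ) → ⟦ C ⟧ (plug Γ (ctxs a′))) → ⟦ C ⟧ (plug Θ (ctxs a))
eval-via C r a k = ⟦⟧-mono C (plug-reindex r a) (k (reindex r a))

eval-prodE : ∀ κ {Δ A B C} (H : HCtx) (a : Env (fill H Δ)) →
             Cover (Pair κ A B) (plug Δ (ctxs (inHole H a))) →
             ((b : Env (fill H (pair κ [ A ] [ B ]))) →
               ⟦ C ⟧ (plug (fill H (pair κ [ A ] [ B ])) (ctxs b))) →
             ⟦ C ⟧ (plug (fill H Δ) (ctxs a))
eval-prodE κ {A = A} {B} {C} H a c k =
  subst ⟦ C ⟧ (sym (plug-fill-split H a)) (⟦⟧-collapse C (Cover-bind-fill H′ continue c))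
  where
  o = outside H a
  H′ = plugH H (proj₁ ∘ o)

  continue-with : ∀ {Γ₁ Γ₂} → ⟦ A ⟧ Γ₁ → ⟦ B ⟧ Γ₂ → ⟦ C ⟧ (fill H′ (pair κ Γ₁ Γ₂))
  continue-with x y =
    subst ⟦ C ⟧ (trans (plug-fillEnv H o (pairEnv κ x y)) (cong (fill H′) (plug-pairEnv κ x y)))
      (k (fillEnv H o (pairEnv κ x y)))

  -- On a neutral product the elimination is kept as a split of the cover.
  continue : ∀ {D} → Pair κ A B D → Cover ⟦ C ⟧ (fill H′ D)
  continue (inj₁ (_ , _ , x , y , s)) = leaf (fill-mono-≼ H′ s) (continue-with x y)
  continue (inj₂ n) = split κ H′ n (leaf ≼-refl (continue-with (⟦⟧-axiom A) (⟦⟧-axiom B))) ≼-refl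

eval : ∀ {Θ C} → Θ ⊢ C → (a : Env Θ) → ⟦ C ⟧ (plug Θ (ctxs a))
eval {C = C} (ax e) a = eval-via C (≅⇒≼ e) a (λ a′ → proj₂ (a′ here))
eval {C = C} (＼e d₁ d₂ e) a =
  eval-via C (≅⇒≼ e) a (λ a′ → eval d₂ (a′ ∘ sr) ≼-refl (eval d₁ (a′ ∘ sl)))
eval {C = C} (／e d₁ d₂ e) a =
  eval-via C (≅⇒≼ e) a (λ a′ → eval d₁ (a′ ∘ sl) ≼-refl (eval d₂ (a′ ∘ sr)))
eval {C = C} (⊸e d₁ d₂ e) a =
  eval-via C (≅⇒≼ e) a (λ a′ → eval d₂ (a′ ∘ pr) ≼-refl (eval d₁ (a′ ∘ pl)))
eval {C = A ＼ C} (＼i d e) a = eval-via (A ＼ C) (≅⇒≼ e) a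
  (λ a′ r x → ⟦⟧-mono C (⨾-mono-≼ ≼-refl r) (eval d (extend-⨾ˡ x a′)))
eval {C = C ／ A} (／i d e) a = eval-via (C ／ A) (≅⇒≼ e) a
  (λ a′ r x → ⟦⟧-mono C (⨾-mono-≼ r ≼-refl) (eval d (extend-⨾ʳ x a′)))
eval {C = A ⊸ C} (⊸i d e) a = eval-via (A ⊸ C) (≅⇒≼ e) a
  (λ a′ r x → ⟦⟧-mono C (,,-mono-≼ ≼-refl r) (eval d (extend-,, x a′)))
eval {C = A ⊙ B} (⊙i d₁ d₂ e) a = eval-via (A ⊙ B) (≅⇒≼ e) a
  (λ a′ → leaf ≼-refl (inj₁ (_ , _ , eval d₁ (a′ ∘ sl) , eval d₂ (a′ ∘ sr) , ≼-refl)))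
eval {C = A ⊗ B} (⊗i d₁ d₂ e) a = eval-via (A ⊗ B) (≅⇒≼ e) a
  (λ a′ → leaf ≼-refl (inj₁ (_ , _ , eval d₁ (a′ ∘ pl) , eval d₂ (a′ ∘ pr) , ≼-refl)))
eval {C = C} (⊙e d₁ H d₂ e) a = eval-via C (≅⇒≼ e) a
  (λ a′ → eval-prodE ser H a′ (eval d₁ (inHole H a′)) (eval d₂))
eval {C = C} (⊗e d₁ H d₂ e) a = eval-via C (≅⇒≼ e) a
  (λ a′ → eval-prodE par H a′ (eval d₁ (inHole H a′)) (eval d₂))
eval {C = C} (ent d r) a = eval-via C r a (eval d)

normalise : ∀ {Γ C} → Γ ⊢ C → Nf Γ C
normalise {Γ} {C} δ =
  reify C (subst ⟦ C ⟧ (plug-singletons Γ) (eval δ (λ p → _ , ⟦⟧-axiom (label p))))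

mainTheorem3 : ∀ {Γ C} (δ : Γ ⊢ C) → Σ (Γ ⊢ C) λ δ′ → Normal δ′
mainTheorem3 δ = let (δ′ , nf) = normalise δ in δ′ , nf⇒Normal nf
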